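{- For any $f\colon\{0,1\}^n\to\{0,1\}$ it holds that $L(f)\ge\mathrm{Adv}_s(f)$.
   Context: $L(f)$ is the minimal number of leaves of a De Morgan formula (binary tree, leaves labeled by literals, internal nodes AND/OR) computing $f$. The soft-adversary bound $\mathrm{Adv}_s(f)$ is the maximum, over all distributions $(\mathbf{a},\mathbf{b})$ supported on $f^{ -1}(1)\times f^{ -1}(0)$, of \[\min_{a\in\mathrm{supp}\,\mathbf{a},\,i\in[n]}\frac{1}{\Pr[\mathbf{a}_i\ne\mathbf{b}_i\mid\mathbf{a}=a]}\cdot\min_{b\in\mathrm{supp}\,\mathbf{b},\,i\in[n]}\frac{1}{\Pr[\mathbf{a}_i\ne\mathbf{b}_i\mid\mathbf{b}=b]}.\]
   Formalization: The distributions $(\mathbf{a},\mathbf{b})$ over which $\mathrm{Adv}_s(f)$ maximizes have rational weights. -}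

module Defs where

open import Data.Bool using (Bool; true; false; _∧_; _∨_; not; _xor_)
open import Data.Nat as ℕ using (ℕ)
open import Data.Fin using (Fin)
open import Data.List using (List; []; _∷_; map; concatMap; foldr)
open import Data.List as L using (allFin)
open import Data.Maybe using (Maybe; just; nothing)
open import Data.Empty using (⊥)
open import Data.Product using (_×_)
open import Relation.Nullary using (yes; no)
open import Relation.Binary.PropositionalEquality using (_≡_; _≢_)
open import Data.Rational using (ℚ; 0ℚ; 1ℚ; _+_; _*_; _÷_; 1/_; _≤_; ≢-nonZero; _⊔_; _⊓_)
open import Data.Rational.Properties using (_≟_)

BoolFun : ℕ → Set
BoolFun n = (Fin n → Bool) → Bool

-- De Morgan formula: binary tree, leaves are literals x_i (lit i true)
-- or ¬x_i (lit i false), internal nodes AND / OR.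
data Formula (n : ℕ) : Set where
  lit  : Fin n → Bool → Formula n
  and  : Formula n → Formula n → Formula n
  or   : Formula n → Formula n → Formula n

eval : ∀ {n} → Formula n → (Fin n → Bool) → Bool
eval (lit i true)  x = x i
eval (lit i false) x = not (x i)
eval (and F G) x = eval F x ∧ eval G x
eval (or F G)  x = eval F x ∨ eval G x

leaves : ∀ {n} → Formula n → ℕ
leaves (lit _ _) = 1
leaves (and F G) = leaves F ℕ.+ leaves G
leaves (or F G)  = leaves F ℕ.+ leaves G

Computes : ∀ {n} → Formula n → BoolFun n → Set
Computes F f = ∀ x → eval F x ≡ f x

allInputs : (n : ℕ) → List (Fin n → Bool)
allInputs ℕ.zero    = (λ ()) ∷ []
allInputs (ℕ.suc n) =
  concatMap (λ x → (λ { Fin.zero → false ; (Fin.suc i) → x i })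
                 ∷ (λ { Fin.zero → true  ; (Fin.suc i) → x i }) ∷ [])
            (allInputs n)

sumℚ : ∀ {A : Set} → List A → (A → ℚ) → ℚ
sumℚ xs g = foldr (λ a s → g a + s) 0ℚ xs

record Distribution {n : ℕ} (f : BoolFun n) : Set where
  field
    μ        : (Fin n → Bool) → (Fin n → Bool) → ℚ
    nonneg   : ∀ x y → 0ℚ ≤ μ x y
    total    : sumℚ (allInputs n) (λ x → sumℚ (allInputs n) (λ y → μ x y)) ≡ 1ℚ
    support  : ∀ x y → μ x y ≢ 0ℚ → (f x ≡ true) × (f y ≡ false)

-- Extended non-negative rationals: nothing = +∞ (used for 1/0 = ∞).

ℚ∞ : Set
ℚ∞ = Maybe ℚ

min∞ : ℚ∞ → ℚ∞ → ℚ∞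
min∞ nothing  q        = q
min∞ p        nothing  = p
min∞ (just p) (just q) = just (p ⊓ q)

mul∞ : ℚ∞ → ℚ∞ → ℚ∞
mul∞ (just p) (just q) = just (p * q)
mul∞ _        _        = nothing

minList∞ : List ℚ∞ → ℚ∞
minList∞ = foldr min∞ nothing

inv∞ : ℚ → ℚ∞
inv∞ p with p ≟ 0ℚ
... | yes _  = nothing
... | no p≢0 = just (1/_ p {{≢-nonZero p≢0}})

_≤∞_ : ℚ∞ → ℚ → Set
nothing ≤∞ q = ⊥
just p  ≤∞ q = p ≤ q

differ : Bool → Bool → ℚ
differ u v = if' (u xor v)
  where
  if' : Bool → ℚ
  if' true  = 1ℚ
  if' false = 0ℚ

module _ {n : ℕ} {f : BoolFun n} (D : Distribution f) where
  open Distribution D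

  PrA : (Fin n → Bool) → ℚ
  PrA x = sumℚ (allInputs n) (λ y → μ x y)

  PrB : (Fin n → Bool) → ℚ
  PrB y = sumℚ (allInputs n) (λ x → μ x y)

  PrADiff : (Fin n → Bool) → Fin n → ℚ
  PrADiff x i = sumℚ (allInputs n) (λ y → μ x y * differ (x i) (y i))

  PrBDiff : (Fin n → Bool) → Fin n → ℚ
  PrBDiff y i = sumℚ (allInputs n) (λ x → μ x y * differ (x i) (y i))

  -- min over a ∈ supp 𝐚, i ∈ [n] of 1 / Pr[𝐚_i ≠ 𝐛_i | 𝐚 = a]
  minA : ℚ∞
  minA = minList∞ (concatMap term (allInputs n))
    where
    term : (Fin n → Bool) → List ℚ∞
    term x with PrA x ≟ 0ℚ
    ... | yes _  = []
    ... | no p≢0 = map (λ i → inv∞ (_÷_ (PrADiff x i) (PrA x) {{≢-nonZero p≢0}}))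
                       (allFin n)

  minB : ℚ∞
  minB = minList∞ (concatMap term (allInputs n))
    where
    term : (Fin n → Bool) → List ℚ∞
    term y with PrB y ≟ 0ℚ
    ... | yes _  = []
    ... | no p≢0 = map (λ i → inv∞ (_÷_ (PrBDiff y i) (PrB y) {{≢-nonZero p≢0}}))
                       (allFin n)

  softAdvValue : ℚ∞
  softAdvValue = mul∞ minA minB

-- Adv_s(f) ≤ k  :⇔  every distribution has soft-adversary value ≤ k
-- (Adv_s(f) is the maximum of softAdvValue over all distributions).
AdvSoft≤ : ∀ {n} → BoolFun n → ℚ → Set
AdvSoft≤ f k = ∀ (D : Distribution f) → softAdvValue D ≤∞ k

{-# OPTIONS --safe #-}
-- Khrapchenko's argument, weighted by the distribution. For A ⊆ F⁻¹(1) and B ⊆ F⁻¹(0) let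
-- m(A,B) = Pr[𝐚 ∈ A ∧ 𝐛 ∈ B]. If p and q lie below the two minima of Adv_s, then by induction on F
--   p · q · m(A,B)² ≤ L(F) · Pr[𝐚 ∈ A] · Pr[𝐛 ∈ B].
-- At a leaf xᵢ every pair in A × B differs in coordinate i, so p · m(A,B) ≤ Pr[𝐚 ∈ A] and
-- q · m(A,B) ≤ Pr[𝐛 ∈ B]. At an AND (OR) node, B (A) is split by the value of the left subformula,
-- and the bound survives because c m₁² ≤ L₁K₁ and c m₂² ≤ L₂K₂ imply c (m₁+m₂)² ≤ (L₁+L₂)(K₁+K₂).
-- For A = f⁻¹(1) and B = f⁻¹(0) we have m(A,B) = 1, whence p · q ≤ L(F).
module Submission where

open import Algebra.Bundles using (CommutativeMonoid)
import Algebra.Properties.CommutativeSemigroup as CommSemigroupProperties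
open import Data.Bool using (Bool; true; false; _∧_; _∨_; not)
open import Data.Bool.Properties using (∧-conicalˡ; ∧-conicalʳ)
open import Data.Fin using (Fin)
open import Data.Integer using (+_)
import Data.Integer as ℤ
import Data.Integer.Properties as ℤ
open import Data.List using (List; []; _∷_; map; concatMap; allFin)
open import Data.List.Membership.Propositional.Properties using (∈-allFin)
open import Data.List.Relation.Unary.All as All using (All; []; _∷_)
import Data.List.Relation.Unary.All.Properties as All
open import Data.Maybe using (just; nothing)
open import Data.Nat as ℕ using (ℕ)
open import Data.Product using (_×_; _,_)
open import Data.Rational
open import Data.Rational.Properties
open import Data.Rational.Solver using (module +-*-Solver)
open import Data.Rational.Unnormalised as ℚᵘ using (mkℚᵘ; *≡*)
import Data.Rational.Unnormalised.Properties as ℚᵘ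
open import Data.Sum using (inj₁; inj₂)
open import Data.Unit using (⊤; tt)
open import Relation.Nullary using (yes; no; contradiction)
open import Relation.Binary.PropositionalEquality
open import Defs

open +-*-Solver

private
  variable
    c p q r s : ℚ

private
  module +-Props = CommSemigroupProperties (CommutativeMonoid.commutativeSemigroup +-0-commutativeMonoid)
  module *-Props = CommSemigroupProperties (CommutativeMonoid.commutativeSemigroup *-1-commutativeMonoid)

toℚ : ℕ → ℚ
toℚ k = + k / 1

toℚ-nonNeg : ∀ k → 0ℚ ≤ toℚ k
toℚ-nonNeg k = nonNegative⁻¹ (toℚ k) {{normalize-nonNeg k 1}}

toℚ-+ : ∀ j k → toℚ (j ℕ.+ k) ≡ toℚ j + toℚ k
toℚ-+ j k = toℚᵘ-injective (begin
  toℚᵘ (toℚ (j ℕ.+ k))                        ≈⟨ toℚᵘ-fromℚᵘ (mkℚᵘ (+ (j ℕ.+ k)) 0) ⟩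
  mkℚᵘ (+ (j ℕ.+ k)) 0                        ≈⟨ *≡* (cong₂ (λ x y → (x ℤ.+ y) ℤ.* + 1)
                                                       (sym (ℤ.*-identityʳ (+ j))) (sym (ℤ.*-identityʳ (+ k)))) ⟩
  mkℚᵘ (+ j) 0 ℚᵘ.+ mkℚᵘ (+ k) 0              ≈⟨ ℚᵘ.+-cong (toℚᵘ-fromℚᵘ (mkℚᵘ (+ j) 0)) (toℚᵘ-fromℚᵘ (mkℚᵘ (+ k) 0)) ⟨
  toℚᵘ (toℚ j) ℚᵘ.+ toℚᵘ (toℚ k)              ≈⟨ toℚᵘ-homo-+ (toℚ j) (toℚ k) ⟨
  toℚᵘ (toℚ j + toℚ k)                        ∎)
  where open ℚᵘ.≃-Reasoning

open ≤-Reasoning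

0≤1 : 0ℚ ≤ 1ℚ
0≤1 = ≤ᵇ⇒≤ tt

*-nonNeg : 0ℚ ≤ p → 0ℚ ≤ q → 0ℚ ≤ p * q
*-nonNeg {p} {q} 0≤p 0≤q =
  nonNegative⁻¹ (p * q) {{nonNeg*nonNeg⇒nonNeg p {{nonNegative 0≤p}} q {{nonNegative 0≤q}}}}

*-mono-≤-nonNeg : 0ℚ ≤ p → p ≤ q → 0ℚ ≤ r → r ≤ s → p * r ≤ q * s
*-mono-≤-nonNeg {p} {q} {r} {s} 0≤p p≤q 0≤r r≤s = begin
  p * r ≤⟨ *-monoʳ-≤-nonNeg r {{nonNegative 0≤r}} p≤q ⟩
  q * r ≤⟨ *-monoˡ-≤-nonNeg q {{nonNegative (≤-trans 0≤p p≤q)}} r≤s ⟩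
  q * s ∎

p*p≥0 : ∀ p → 0ℚ ≤ p * p
p*p≥0 p with ≤-total 0ℚ p
... | inj₁ 0≤p = *-nonNeg 0≤p 0≤p
... | inj₂ p≤0 = nonNegative⁻¹ (p * p) {{nonPos*nonPos⇒nonPos p {{nonPositive p≤0}} p {{nonPositive p≤0}}}}

p*p≤q*q⇒p≤q : 0ℚ ≤ q → p * p ≤ q * q → p ≤ q
p*p≤q*q⇒p≤q {q} {p} 0≤q pp≤qq = ≮⇒≥ λ q<p → <-irrefl refl (<-≤-trans (qq<pp q<p) pp≤qq)
  where
  qq<pp : q < p → q * q < p * p
  qq<pp q<p = ≤-<-trans (*-monoˡ-≤-nonNeg q {{nonNegative 0≤q}} (<⇒≤ q<p))
                        (*-monoˡ-<-pos p {{positive (≤-<-trans 0≤q q<p)}} q<p)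

[a+a]*[b+b]≤[a+b]*[a+b] : ∀ a b → (a + a) * (b + b) ≤ (a + b) * (a + b)
[a+a]*[b+b]≤[a+b]*[a+b] a b = begin
  (a + a) * (b + b)                     ≡⟨ +-identityʳ _ ⟨
  (a + a) * (b + b) + 0ℚ                ≤⟨ +-monoʳ-≤ ((a + a) * (b + b)) (p*p≥0 (a - b)) ⟩
  (a + a) * (b + b) + (a - b) * (a - b) ≡⟨ solve 2 (λ a b → (a :+ a) :* (b :+ b) :+ (a :- b) :* (a :- b)
                                                      := (a :+ b) :* (a :+ b)) refl a b ⟩
  (a + b) * (a + b)                     ∎

-- Squaring avoids square roots: (2cm₁m₂)² = (2cm₁²)(2cm₂²) ≤ (2L₁K₁)(2L₂K₂) ≤ (L₁K₂ + L₂K₁)².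
cross-term-≤ : ∀ {L₁ L₂ K₁ K₂} m₁ m₂ → 0ℚ ≤ c →
  0ℚ ≤ L₁ → 0ℚ ≤ L₂ → 0ℚ ≤ K₁ → 0ℚ ≤ K₂ →
  c * (m₁ * m₁) ≤ L₁ * K₁ → c * (m₂ * m₂) ≤ L₂ * K₂ →
  c * (m₁ * m₂) + c * (m₁ * m₂) ≤ L₁ * K₂ + L₂ * K₁
cross-term-≤ {c} {L₁} {L₂} {K₁} {K₂} m₁ m₂ 0≤c 0≤L₁ 0≤L₂ 0≤K₁ 0≤K₂ bound₁ bound₂ = p*p≤q*q⇒p≤q 0≤U (begin
  (u + u) * (u + u)                                 ≡⟨ solve 3 (λ c m₁ m₂ →
      (c :* (m₁ :* m₂) :+ c :* (m₁ :* m₂)) :* (c :* (m₁ :* m₂) :+ c :* (m₁ :* m₂))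
        := (c :* (m₁ :* m₁) :+ c :* (m₁ :* m₁)) :* (c :* (m₂ :* m₂) :+ c :* (m₂ :* m₂))) refl c m₁ m₂ ⟩
  (c₁ + c₁) * (c₂ + c₂)                             ≤⟨ *-mono-≤-nonNeg (double-nonNeg c₁≥0) (+-mono-≤ bound₁ bound₁)
                                                                        (double-nonNeg c₂≥0) (+-mono-≤ bound₂ bound₂) ⟩
  (L₁ * K₁ + L₁ * K₁) * (L₂ * K₂ + L₂ * K₂)         ≡⟨ solve 4 (λ L₁ L₂ K₁ K₂ →
      (L₁ :* K₁ :+ L₁ :* K₁) :* (L₂ :* K₂ :+ L₂ :* K₂)
        := (L₁ :* K₂ :+ L₁ :* K₂) :* (L₂ :* K₁ :+ L₂ :* K₁)) refl L₁ L₂ K₁ K₂ ⟩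
  (L₁ * K₂ + L₁ * K₂) * (L₂ * K₁ + L₂ * K₁)         ≤⟨ [a+a]*[b+b]≤[a+b]*[a+b] (L₁ * K₂) (L₂ * K₁) ⟩
  (L₁ * K₂ + L₂ * K₁) * (L₁ * K₂ + L₂ * K₁)         ∎)
  where
  u  = c * (m₁ * m₂)
  c₁ = c * (m₁ * m₁)
  c₂ = c * (m₂ * m₂)
  c₁≥0 = *-nonNeg 0≤c (p*p≥0 m₁)
  c₂≥0 = *-nonNeg 0≤c (p*p≥0 m₂)
  0≤U = +-mono-≤ (*-nonNeg 0≤L₁ 0≤K₂) (*-nonNeg 0≤L₂ 0≤K₁)
  double-nonNeg : 0ℚ ≤ r → 0ℚ ≤ r + r
  double-nonNeg 0≤r = +-mono-≤ 0≤r 0≤r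

square-bound-+ : ∀ {L₁ L₂ K₁ K₂} m₁ m₂ → 0ℚ ≤ c →
  0ℚ ≤ L₁ → 0ℚ ≤ L₂ → 0ℚ ≤ K₁ → 0ℚ ≤ K₂ →
  c * (m₁ * m₁) ≤ L₁ * K₁ → c * (m₂ * m₂) ≤ L₂ * K₂ →
  c * ((m₁ + m₂) * (m₁ + m₂)) ≤ (L₁ + L₂) * (K₁ + K₂)
square-bound-+ {c} {L₁} {L₂} {K₁} {K₂} m₁ m₂ 0≤c 0≤L₁ 0≤L₂ 0≤K₁ 0≤K₂ bound₁ bound₂ = begin
  c * ((m₁ + m₂) * (m₁ + m₂))
    ≡⟨ solve 3 (λ c m₁ m₂ → c :* ((m₁ :+ m₂) :* (m₁ :+ m₂))
                := c :* (m₁ :* m₁) :+ c :* (m₂ :* m₂) :+ (c :* (m₁ :* m₂) :+ c :* (m₁ :* m₂))) refl c m₁ m₂ ⟩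
  c * (m₁ * m₁) + c * (m₂ * m₂) + (c * (m₁ * m₂) + c * (m₁ * m₂))
    ≤⟨ +-mono-≤ (+-mono-≤ bound₁ bound₂) (cross-term-≤ m₁ m₂ 0≤c 0≤L₁ 0≤L₂ 0≤K₁ 0≤K₂ bound₁ bound₂) ⟩
  L₁ * K₁ + L₂ * K₂ + (L₁ * K₂ + L₂ * K₁)
    ≡⟨ solve 4 (λ L₁ L₂ K₁ K₂ → L₁ :* K₁ :+ L₂ :* K₂ :+ (L₁ :* K₂ :+ L₂ :* K₁)
                := (L₁ :+ L₂) :* (K₁ :+ K₂)) refl L₁ L₂ K₁ K₂ ⟩
  (L₁ + L₂) * (K₁ + K₂) ∎

module _ {A : Set} where

  sumℚ-cong : ∀ xs {g h : A → ℚ} → (∀ x → g x ≡ h x) → sumℚ xs g ≡ sumℚ xs h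
  sumℚ-cong []       g≗h = refl
  sumℚ-cong (x ∷ xs) g≗h = cong₂ _+_ (g≗h x) (sumℚ-cong xs g≗h)

  sumℚ-+ : ∀ xs (g h : A → ℚ) → sumℚ xs (λ x → g x + h x) ≡ sumℚ xs g + sumℚ xs h
  sumℚ-+ []       g h = refl
  sumℚ-+ (x ∷ xs) g h = trans (cong (_+_ (g x + h x)) (sumℚ-+ xs g h))
                              (+-Props.interchange (g x) (h x) (sumℚ xs g) (sumℚ xs h))

  sumℚ-*ˡ : ∀ xs c (g : A → ℚ) → sumℚ xs (λ x → c * g x) ≡ c * sumℚ xs g
  sumℚ-*ˡ []       c g = sym (*-zeroʳ c)
  sumℚ-*ˡ (x ∷ xs) c g = trans (cong (_+_ (c * g x)) (sumℚ-*ˡ xs c g)) (sym (*-distribˡ-+ c (g x) (sumℚ xs g)))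

  sumℚ-mono : ∀ {xs} {g h : A → ℚ} → All (λ x → g x ≤ h x) xs → sumℚ xs g ≤ sumℚ xs h
  sumℚ-mono []           = ≤-refl
  sumℚ-mono (g≤h ∷ g≤hs) = +-mono-≤ g≤h (sumℚ-mono g≤hs)

  sumℚ-nonNeg : ∀ xs {g : A → ℚ} → (∀ x → 0ℚ ≤ g x) → 0ℚ ≤ sumℚ xs g
  sumℚ-nonNeg []       g≥0 = ≤-refl
  sumℚ-nonNeg (x ∷ xs) g≥0 = +-mono-≤ (g≥0 x) (sumℚ-nonNeg xs g≥0)

sumℚ-comm : ∀ {A B : Set} xs ys (g : A → B → ℚ) →
  sumℚ xs (λ x → sumℚ ys (g x)) ≡ sumℚ ys (λ y → sumℚ xs (λ x → g x y))
sumℚ-comm []       ys g = sym (zeros ys)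
  where
  zeros : ∀ ys → sumℚ ys (λ _ → 0ℚ) ≡ 0ℚ
  zeros []       = refl
  zeros (_ ∷ ys) = trans (+-identityˡ _) (zeros ys)
sumℚ-comm (x ∷ xs) ys g = trans (cong (_+_ (sumℚ ys (g x))) (sumℚ-comm xs ys g))
                                (sym (sumℚ-+ ys (g x) (λ y → sumℚ xs (λ x → g x y))))

𝟙 : Bool → ℚ
𝟙 true  = 1ℚ
𝟙 false = 0ℚ

𝟙-nonNeg : ∀ b → 0ℚ ≤ 𝟙 b
𝟙-nonNeg true  = 0≤1
𝟙-nonNeg false = ≤-refl

𝟙*-mono : ∀ b → (b ≡ true → p ≤ q) → 𝟙 b * p ≤ 𝟙 b * q
𝟙*-mono {p} {q} true  p≤q = *-monoˡ-≤-nonNeg 1ℚ (p≤q refl)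
𝟙*-mono {p} {q} false _   = ≤-reflexive (trans (*-zeroˡ p) (sym (*-zeroˡ q)))

𝟙*-≤ : ∀ b → 0ℚ ≤ q → (b ≡ true → p ≤ q) → 𝟙 b * p ≤ q
𝟙*-≤ {q} {p} true  _   p≤q = ≤-trans (≤-reflexive (*-identityˡ p)) (p≤q refl)
𝟙*-≤ {q} {p} false 0≤q _   = subst (_≤ q) (sym (*-zeroˡ p)) 0≤q

module _ {n : ℕ} where

  _∩_ : BoolFun n → BoolFun n → BoolFun n
  (A ∩ C) x = A x ∧ C x

  ∁ : BoolFun n → BoolFun n
  ∁ A x = not (A x)

  _⊆_ : BoolFun n → BoolFun n → Set
  A ⊆ B = ∀ x → A x ≡ true → B x ≡ true

  record Partition (A A₁ A₂ : BoolFun n) : Set where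
    constructor partition
    field 𝟙-split : ∀ x → 𝟙 (A x) ≡ 𝟙 (A₁ x) + 𝟙 (A₂ x)
  open Partition

  ∩-∁-partition : ∀ A C → Partition A (A ∩ C) (A ∩ ∁ C)
  ∩-∁-partition A C = partition split
    where
    split : ∀ x → 𝟙 (A x) ≡ 𝟙 (A x ∧ C x) + 𝟙 (A x ∧ not (C x))
    split x with A x | C x
    ... | false | _     = refl
    ... | true  | true  = refl
    ... | true  | false = refl

  partition-swap : ∀ {A A₁ A₂} → Partition A A₁ A₂ → Partition A A₂ A₁
  partition-swap {A₁ = A₁} {A₂} part = partition λ x → trans (𝟙-split part x) (+-comm (𝟙 (A₁ x)) (𝟙 (A₂ x)))

  Σ⟨_⟩_ : BoolFun n → ((Fin n → Bool) → ℚ) → ℚ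
  Σ⟨ A ⟩ w = sumℚ (allInputs n) (λ x → 𝟙 (A x) * w x)

  Σ⟨⟩-partition : ∀ {A A₁ A₂} → Partition A A₁ A₂ → ∀ w → Σ⟨ A ⟩ w ≡ Σ⟨ A₁ ⟩ w + Σ⟨ A₂ ⟩ w
  Σ⟨⟩-partition {A₁ = A₁} {A₂} part w = trans
    (sumℚ-cong (allInputs n) λ x → trans (cong (_* w x) (𝟙-split part x)) (*-distribʳ-+ (w x) (𝟙 (A₁ x)) (𝟙 (A₂ x))))
    (sumℚ-+ (allInputs n) (λ x → 𝟙 (A₁ x) * w x) (λ x → 𝟙 (A₂ x) * w x))

  Σ⟨⟩-+ : ∀ A g h → Σ⟨ A ⟩ (λ x → g x + h x) ≡ Σ⟨ A ⟩ g + Σ⟨ A ⟩ h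
  Σ⟨⟩-+ A g h = trans (sumℚ-cong (allInputs n) λ x → *-distribˡ-+ (𝟙 (A x)) (g x) (h x))
                      (sumℚ-+ (allInputs n) (λ x → 𝟙 (A x) * g x) (λ x → 𝟙 (A x) * h x))

  Σ⟨⟩-*ˡ : ∀ A c w → Σ⟨ A ⟩ (λ x → c * w x) ≡ c * Σ⟨ A ⟩ w
  Σ⟨⟩-*ˡ A c w = trans (sumℚ-cong (allInputs n) λ x → *-Props.x∙yz≈y∙xz (𝟙 (A x)) c (w x))
                       (sumℚ-*ˡ (allInputs n) c _)

  Σ⟨⟩-nonNeg : ∀ A {w} → (∀ x → 0ℚ ≤ w x) → 0ℚ ≤ Σ⟨ A ⟩ w
  Σ⟨⟩-nonNeg A w≥0 = sumℚ-nonNeg (allInputs n) λ x → *-nonNeg (𝟙-nonNeg (A x)) (w≥0 x)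

  Σ⟨⟩-≤-sum : ∀ A {w} → (∀ x → 0ℚ ≤ w x) → Σ⟨ A ⟩ w ≤ sumℚ (allInputs n) w
  Σ⟨⟩-≤-sum A w≥0 = sumℚ-mono (All.universal (λ x → 𝟙*-≤ (A x) (w≥0 x) λ _ → ≤-refl) (allInputs n))

  Σ⟨⟩-scaled-≤ : ∀ p A g {h} → All (λ x → A x ≡ true → p * g x ≤ h x) (allInputs n) →
    p * Σ⟨ A ⟩ g ≤ Σ⟨ A ⟩ h
  Σ⟨⟩-scaled-≤ p A g {h} bound = begin
    p * Σ⟨ A ⟩ g                ≡⟨ Σ⟨⟩-*ˡ A p g ⟨
    Σ⟨ A ⟩ (λ x → p * g x)      ≤⟨ sumℚ-mono (All.map (λ {x} → 𝟙*-mono (A x)) bound) ⟩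
    Σ⟨ A ⟩ h                    ∎

  Σ⟨⟩-separated : ∀ A {w d : (Fin n → Bool) → ℚ} → (∀ x → 0ℚ ≤ w x) → (∀ x → 0ℚ ≤ d x) →
    (∀ x → A x ≡ true → d x ≡ 1ℚ) → Σ⟨ A ⟩ w ≤ sumℚ (allInputs n) (λ x → w x * d x)
  Σ⟨⟩-separated A {w} {d} w≥0 d≥0 d≡1 = sumℚ-mono (All.universal pointwise (allInputs n))
    where
    pointwise : ∀ x → 𝟙 (A x) * w x ≤ w x * d x
    pointwise x = 𝟙*-≤ (A x) (*-nonNeg (w≥0 x) (d≥0 x)) λ x∈A →
      ≤-reflexive (sym (trans (cong (w x *_) (d≡1 x x∈A)) (*-identityʳ (w x))))

private
  variable
    u v : Bool

not-∧⁻ʳ : u ≡ true → not (u ∧ v) ≡ true → not v ≡ true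
not-∧⁻ʳ refl ¬v = ¬v

not-∨⁻ˡ : not (u ∨ v) ≡ true → not u ≡ true
not-∨⁻ˡ {false} _ = refl

not-∨⁻ʳ : not (u ∨ v) ≡ true → not v ≡ true
not-∨⁻ʳ {false} ¬v = ¬v

∨-resolve : not u ≡ true → u ∨ v ≡ true → v ≡ true
∨-resolve {false} _ v = v

differ-nonNeg : ∀ u v → 0ℚ ≤ differ u v
differ-nonNeg false false = ≤-refl
differ-nonNeg false true  = 0≤1
differ-nonNeg true  false = 0≤1
differ-nonNeg true  true  = ≤-refl

differ≤1 : ∀ u v → differ u v ≤ 1ℚ
differ≤1 false false = 0≤1
differ≤1 false true  = ≤-refl
differ≤1 true  false = ≤-refl
differ≤1 true  true  = 0≤1

lit-separates : ∀ {n} i c (x y : Fin n → Bool) →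
  eval (lit i c) x ≡ true → ∁ (eval (lit i c)) y ≡ true → differ (x i) (y i) ≡ 1ℚ
lit-separates i true  x y x∈ y∉ with x i | y i
... | true  | false = refl
... | false | _     = contradiction x∈ λ ()
... | true  | true  = contradiction y∉ λ ()
lit-separates i false x y x∈ y∉ with x i | y i
... | false | true  = refl
... | true  | _     = contradiction x∈ λ ()
... | false | false = contradiction y∉ λ ()

module _ {n : ℕ} {f : BoolFun n} (D : Distribution f) where
  open Distribution D

  PrA-nonNeg : ∀ x → 0ℚ ≤ PrA D x
  PrA-nonNeg x = sumℚ-nonNeg (allInputs n) (nonneg x)

  PrB-nonNeg : ∀ y → 0ℚ ≤ PrB D y
  PrB-nonNeg y = sumℚ-nonNeg (allInputs n) λ x → nonneg x y

  private
    μ*differ-nonNeg : ∀ i x y → 0ℚ ≤ μ x y * differ (x i) (y i)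
    μ*differ-nonNeg i x y = *-nonNeg (nonneg x y) (differ-nonNeg (x i) (y i))

    μ*differ≤μ : ∀ i x y → μ x y * differ (x i) (y i) ≤ μ x y
    μ*differ≤μ i x y = ≤-trans (*-monoˡ-≤-nonNeg (μ x y) {{nonNegative (nonneg x y)}} (differ≤1 (x i) (y i)))
                               (≤-reflexive (*-identityʳ (μ x y)))

  PrADiff-nonNeg : ∀ x i → 0ℚ ≤ PrADiff D x i
  PrADiff-nonNeg x i = sumℚ-nonNeg (allInputs n) (μ*differ-nonNeg i x)

  PrBDiff-nonNeg : ∀ y i → 0ℚ ≤ PrBDiff D y i
  PrBDiff-nonNeg y i = sumℚ-nonNeg (allInputs n) λ x → μ*differ-nonNeg i x y

  PrADiff≤PrA : ∀ x i → PrADiff D x i ≤ PrA D x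
  PrADiff≤PrA x i = sumℚ-mono (All.universal (μ*differ≤μ i x) (allInputs n))

  PrBDiff≤PrB : ∀ y i → PrBDiff D y i ≤ PrB D y
  PrBDiff≤PrB y i = sumℚ-mono (All.universal (λ x → μ*differ≤μ i x y) (allInputs n))

  Σ⟨⟩-PrA≤1 : ∀ A → Σ⟨ A ⟩ PrA D ≤ 1ℚ
  Σ⟨⟩-PrA≤1 A = ≤-trans (Σ⟨⟩-≤-sum A PrA-nonNeg) (≤-reflexive total)

  Σ⟨⟩-PrB≤1 : ∀ B → Σ⟨ B ⟩ PrB D ≤ 1ℚ
  Σ⟨⟩-PrB≤1 B = ≤-trans (Σ⟨⟩-≤-sum B PrB-nonNeg)
                        (≤-reflexive (trans (sym (sumℚ-comm (allInputs n) (allInputs n) μ)) total))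

  mass : BoolFun n → BoolFun n → ℚ
  mass A B = Σ⟨ A ⟩ λ x → Σ⟨ B ⟩ μ x

  mass-nonNeg : ∀ A B → 0ℚ ≤ mass A B
  mass-nonNeg A B = Σ⟨⟩-nonNeg A λ x → Σ⟨⟩-nonNeg B (nonneg x)

  mass-transpose : ∀ A B → mass A B ≡ Σ⟨ B ⟩ λ y → Σ⟨ A ⟩ λ x → μ x y
  mass-transpose A B = begin-equality
    sumℚ X (λ x → 𝟙 (A x) * sumℚ X (λ y → 𝟙 (B y) * μ x y))
      ≡⟨ sumℚ-cong X (λ x → sumℚ-*ˡ X (𝟙 (A x)) _) ⟨
    sumℚ X (λ x → sumℚ X (λ y → 𝟙 (A x) * (𝟙 (B y) * μ x y)))
      ≡⟨ sumℚ-comm X X (λ x y → 𝟙 (A x) * (𝟙 (B y) * μ x y)) ⟩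
    sumℚ X (λ y → sumℚ X (λ x → 𝟙 (A x) * (𝟙 (B y) * μ x y)))
      ≡⟨ sumℚ-cong X (λ y → sumℚ-cong X λ x → *-Props.x∙yz≈y∙xz (𝟙 (A x)) (𝟙 (B y)) (μ x y)) ⟩
    sumℚ X (λ y → sumℚ X (λ x → 𝟙 (B y) * (𝟙 (A x) * μ x y)))
      ≡⟨ sumℚ-cong X (λ y → sumℚ-*ˡ X (𝟙 (B y)) _) ⟩
    sumℚ X (λ y → 𝟙 (B y) * sumℚ X (λ x → 𝟙 (A x) * μ x y)) ∎
    where X = allInputs n

  mass-partitionˡ : ∀ {A A₁ A₂} B → Partition A A₁ A₂ → mass A B ≡ mass A₁ B + mass A₂ B
  mass-partitionˡ B part = Σ⟨⟩-partition part λ x → Σ⟨ B ⟩ μ x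

  mass-partitionʳ : ∀ A {B B₁ B₂} → Partition B B₁ B₂ → mass A B ≡ mass A B₁ + mass A B₂
  mass-partitionʳ A {B₁ = B₁} {B₂} part =
    trans (sumℚ-cong (allInputs n) λ x → cong (𝟙 (A x) *_) (Σ⟨⟩-partition part (μ x)))
          (Σ⟨⟩-+ A (λ x → Σ⟨ B₁ ⟩ μ x) (λ x → Σ⟨ B₂ ⟩ μ x))

  mass-support : mass f (∁ f) ≡ 1ℚ
  mass-support = begin-equality
    sumℚ X (λ x → 𝟙 (f x) * sumℚ X (λ y → 𝟙 (not (f y)) * μ x y))
      ≡⟨ sumℚ-cong X (λ x → sumℚ-*ˡ X (𝟙 (f x)) _) ⟨
    sumℚ X (λ x → sumℚ X (λ y → 𝟙 (f x) * (𝟙 (not (f y)) * μ x y)))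
      ≡⟨ sumℚ-cong X (λ x → sumℚ-cong X (supported x)) ⟩
    sumℚ X (λ x → sumℚ X (λ y → μ x y))
      ≡⟨ total ⟩
    1ℚ ∎
    where
    X = allInputs n
    supported : ∀ x y → 𝟙 (f x) * (𝟙 (not (f y)) * μ x y) ≡ μ x y
    supported x y with μ x y ≟ 0ℚ
    ... | yes μ≡0 rewrite μ≡0 = trans (cong (𝟙 (f x) *_) (*-zeroʳ (𝟙 (not (f y))))) (*-zeroʳ (𝟙 (f x)))
    ... | no μ≢0 with support x y μ≢0
    ... | fx≡1 , fy≡0 rewrite fx≡1 | fy≡0 = trans (*-identityˡ _) (*-identityˡ _)

  record RectangleBound (c : ℚ) (L : ℕ) (A B : BoolFun n) : Set where
    constructor rectangleBound
    field bound : c * (mass A B * mass A B) ≤ toℚ L * (Σ⟨ A ⟩ PrA D * Σ⟨ B ⟩ PrB D)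
  open RectangleBound

  rectangleBound-partitionˡ : ∀ {c L₁ L₂ A A₁ A₂ B} → 0ℚ ≤ c → Partition A A₁ A₂ →
    RectangleBound c L₁ A₁ B → RectangleBound c L₂ A₂ B → RectangleBound c (L₁ ℕ.+ L₂) A B
  rectangleBound-partitionˡ {c} {L₁} {L₂} {A} {A₁} {A₂} {B} 0≤c part bound₁ bound₂ = rectangleBound (begin
    c * (mass A B * mass A B)
      ≡⟨ cong (λ m → c * (m * m)) (mass-partitionˡ B part) ⟩
    c * ((mass A₁ B + mass A₂ B) * (mass A₁ B + mass A₂ B))
      ≤⟨ square-bound-+ (mass A₁ B) (mass A₂ B) 0≤c (toℚ-nonNeg L₁) (toℚ-nonNeg L₂)
           (*-nonNeg (Σ⟨⟩-nonNeg A₁ PrA-nonNeg) (Σ⟨⟩-nonNeg B PrB-nonNeg))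
           (*-nonNeg (Σ⟨⟩-nonNeg A₂ PrA-nonNeg) (Σ⟨⟩-nonNeg B PrB-nonNeg)) (bound bound₁) (bound bound₂) ⟩
    (toℚ L₁ + toℚ L₂) * (Σ⟨ A₁ ⟩ PrA D * Σ⟨ B ⟩ PrB D + Σ⟨ A₂ ⟩ PrA D * Σ⟨ B ⟩ PrB D)
      ≡⟨ cong₂ _*_ (toℚ-+ L₁ L₂) (trans (cong (_* Σ⟨ B ⟩ PrB D) (Σ⟨⟩-partition part (PrA D)))
                                        (*-distribʳ-+ (Σ⟨ B ⟩ PrB D) (Σ⟨ A₁ ⟩ PrA D) (Σ⟨ A₂ ⟩ PrA D))) ⟨
    toℚ (L₁ ℕ.+ L₂) * (Σ⟨ A ⟩ PrA D * Σ⟨ B ⟩ PrB D) ∎)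

  rectangleBound-partitionʳ : ∀ {c L₁ L₂ A B B₁ B₂} → 0ℚ ≤ c → Partition B B₁ B₂ →
    RectangleBound c L₁ A B₁ → RectangleBound c L₂ A B₂ → RectangleBound c (L₁ ℕ.+ L₂) A B
  rectangleBound-partitionʳ {c} {L₁} {L₂} {A} {B} {B₁} {B₂} 0≤c part bound₁ bound₂ = rectangleBound (begin
    c * (mass A B * mass A B)
      ≡⟨ cong (λ m → c * (m * m)) (mass-partitionʳ A part) ⟩
    c * ((mass A B₁ + mass A B₂) * (mass A B₁ + mass A B₂))
      ≤⟨ square-bound-+ (mass A B₁) (mass A B₂) 0≤c (toℚ-nonNeg L₁) (toℚ-nonNeg L₂)
           (*-nonNeg (Σ⟨⟩-nonNeg A PrA-nonNeg) (Σ⟨⟩-nonNeg B₁ PrB-nonNeg))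
           (*-nonNeg (Σ⟨⟩-nonNeg A PrA-nonNeg) (Σ⟨⟩-nonNeg B₂ PrB-nonNeg)) (bound bound₁) (bound bound₂) ⟩
    (toℚ L₁ + toℚ L₂) * (Σ⟨ A ⟩ PrA D * Σ⟨ B₁ ⟩ PrB D + Σ⟨ A ⟩ PrA D * Σ⟨ B₂ ⟩ PrB D)
      ≡⟨ cong₂ _*_ (toℚ-+ L₁ L₂) (trans (cong (Σ⟨ A ⟩ PrA D *_) (Σ⟨⟩-partition part (PrB D)))
                                        (*-distribˡ-+ (Σ⟨ A ⟩ PrA D) (Σ⟨ B₁ ⟩ PrB D) (Σ⟨ B₂ ⟩ PrB D))) ⟨
    toℚ (L₁ ℕ.+ L₂) * (Σ⟨ A ⟩ PrA D * Σ⟨ B ⟩ PrB D) ∎)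

  -- p ≤ 1 / Pr[𝐚ᵢ ≠ 𝐛ᵢ ∣ 𝐚 = x] for all x and i, with the denominator cleared.
  RowBounded : ℚ → Set
  RowBounded p = All (λ x → ∀ i → p * PrADiff D x i ≤ PrA D x) (allInputs n)

  ColBounded : ℚ → Set
  ColBounded q = All (λ y → ∀ i → q * PrBDiff D y i ≤ PrB D y) (allInputs n)

  rowBounded-1 : RowBounded 1ℚ
  rowBounded-1 = All.universal (λ x i → ≤-trans (≤-reflexive (*-identityˡ _)) (PrADiff≤PrA x i)) (allInputs n)

  colBounded-1 : ColBounded 1ℚ
  colBounded-1 = All.universal (λ y i → ≤-trans (≤-reflexive (*-identityˡ _)) (PrBDiff≤PrB y i)) (allInputs n)

  module _ {p q} (0≤p : 0ℚ ≤ p) (0≤q : 0ℚ ≤ q) (rows : RowBounded p) (cols : ColBounded q) where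

    lit-rowBound : ∀ i c {A B} → A ⊆ eval (lit i c) → B ⊆ ∁ (eval (lit i c)) → p * mass A B ≤ Σ⟨ A ⟩ PrA D
    lit-rowBound i c {A} {B} A⊆ B⊆ = Σ⟨⟩-scaled-≤ p A (λ x → Σ⟨ B ⟩ μ x) (All.map row-step rows)
      where
      row-step : ∀ {x} → (∀ j → p * PrADiff D x j ≤ PrA D x) → A x ≡ true → p * Σ⟨ B ⟩ μ x ≤ PrA D x
      row-step {x} row x∈A = ≤-trans (*-monoˡ-≤-nonNeg p {{nonNegative 0≤p}} separated) (row i)
        where
        separated : Σ⟨ B ⟩ μ x ≤ PrADiff D x i
        separated = Σ⟨⟩-separated B (nonneg x) (λ y → differ-nonNeg (x i) (y i))
                      λ y y∈B → lit-separates i c x y (A⊆ x x∈A) (B⊆ y y∈B)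

    lit-colBound : ∀ i c {A B} → A ⊆ eval (lit i c) → B ⊆ ∁ (eval (lit i c)) → q * mass A B ≤ Σ⟨ B ⟩ PrB D
    lit-colBound i c {A} {B} A⊆ B⊆ rewrite mass-transpose A B =
      Σ⟨⟩-scaled-≤ q B (λ y → Σ⟨ A ⟩ λ x → μ x y) (All.map col-step cols)
      where
      col-step : ∀ {y} → (∀ j → q * PrBDiff D y j ≤ PrB D y) → B y ≡ true → q * Σ⟨ A ⟩ (λ x → μ x y) ≤ PrB D y
      col-step {y} col y∈B = ≤-trans (*-monoˡ-≤-nonNeg q {{nonNegative 0≤q}} separated) (col i)
        where
        separated : Σ⟨ A ⟩ (λ x → μ x y) ≤ PrBDiff D y i
        separated = Σ⟨⟩-separated A (λ x → nonneg x y) (λ x → differ-nonNeg (x i) (y i))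
                      λ x x∈A → lit-separates i c x y (A⊆ x x∈A) (B⊆ y y∈B)

    lit-rectangleBound : ∀ i c {A B} → A ⊆ eval (lit i c) → B ⊆ ∁ (eval (lit i c)) → RectangleBound (p * q) 1 A B
    lit-rectangleBound i c {A} {B} A⊆ B⊆ = rectangleBound (begin
      p * q * (mass A B * mass A B)
        ≡⟨ solve 3 (λ p q m → p :* q :* (m :* m) := (p :* m) :* (q :* m)) refl p q (mass A B) ⟩
      (p * mass A B) * (q * mass A B)
        ≤⟨ *-mono-≤-nonNeg (*-nonNeg 0≤p (mass-nonNeg A B)) (lit-rowBound i c A⊆ B⊆)
                           (*-nonNeg 0≤q (mass-nonNeg A B)) (lit-colBound i c A⊆ B⊆) ⟩
      Σ⟨ A ⟩ PrA D * Σ⟨ B ⟩ PrB D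
        ≡⟨ *-identityˡ _ ⟨
      1ℚ * (Σ⟨ A ⟩ PrA D * Σ⟨ B ⟩ PrB D) ∎)

    formula-rectangleBound : ∀ F {A B} → A ⊆ eval F → B ⊆ ∁ (eval F) → RectangleBound (p * q) (leaves F) A B
    formula-rectangleBound (lit i c) A⊆ B⊆ = lit-rectangleBound i c A⊆ B⊆
    formula-rectangleBound (and F G) {B = B} A⊆ B⊆ =
      rectangleBound-partitionʳ (*-nonNeg 0≤p 0≤q) (partition-swap (∩-∁-partition B (eval F)))
        (formula-rectangleBound F (λ x x∈A → ∧-conicalˡ _ _ (A⊆ x x∈A)) λ y → ∧-conicalʳ _ _)
        (formula-rectangleBound G (λ x x∈A → ∧-conicalʳ _ _ (A⊆ x x∈A))
                                  λ y y∈ → not-∧⁻ʳ (∧-conicalʳ _ _ y∈) (B⊆ y (∧-conicalˡ _ _ y∈)))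
    formula-rectangleBound (or F G) {A} A⊆ B⊆ =
      rectangleBound-partitionˡ (*-nonNeg 0≤p 0≤q) (∩-∁-partition A (eval F))
        (formula-rectangleBound F (λ x → ∧-conicalʳ _ _) λ y y∈B → not-∨⁻ˡ (B⊆ y y∈B))
        (formula-rectangleBound G (λ x x∈ → ∨-resolve (∧-conicalʳ _ _ x∈) (A⊆ x (∧-conicalˡ _ _ x∈)))
                                  λ y y∈B → not-∨⁻ʳ (B⊆ y y∈B))

    formula-softBound : ∀ F → Computes F f → p * q ≤ toℚ (leaves F)
    formula-softBound F computes = begin
      p * q                                    ≡⟨ *-identityʳ (p * q) ⟨
      p * q * (1ℚ * 1ℚ)                        ≡⟨ cong (λ m → p * q * (m * m)) mass-support ⟨
      p * q * (mass f (∁ f) * mass f (∁ f))    ≤⟨ bound (formula-rectangleBound F f⊆F ∁f⊆∁F) ⟩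
      L * (Σ⟨ f ⟩ PrA D * Σ⟨ ∁ f ⟩ PrB D)      ≤⟨ *-monoˡ-≤-nonNeg L {{nonNegative (toℚ-nonNeg (leaves F))}} probabilities≤1 ⟩
      L * (1ℚ * 1ℚ)                            ≡⟨ *-identityʳ L ⟩
      L                                        ∎
      where
      L = toℚ (leaves F)
      f⊆F : f ⊆ eval F
      f⊆F x fx≡1 = trans (computes x) fx≡1
      ∁f⊆∁F : ∁ f ⊆ ∁ (eval F)
      ∁f⊆∁F y ¬fy≡1 = trans (cong not (computes y)) ¬fy≡1
      probabilities≤1 : Σ⟨ f ⟩ PrA D * Σ⟨ ∁ f ⟩ PrB D ≤ 1ℚ * 1ℚ
      probabilities≤1 = *-mono-≤-nonNeg (Σ⟨⟩-nonNeg f PrA-nonNeg) (Σ⟨⟩-PrA≤1 f)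
                                        (Σ⟨⟩-nonNeg (∁ f) PrB-nonNeg) (Σ⟨⟩-PrB≤1 (∁ f))

_≼_ : ℚ → ℚ∞ → Set
p ≼ nothing = ⊤
p ≼ just q  = p ≤ q

≼-min∞⁺ : ∀ {e e′} → p ≼ e → p ≼ e′ → p ≼ min∞ e e′
≼-min∞⁺ {e = nothing}             _   p≼e′ = p≼e′
≼-min∞⁺ {e = just _} {nothing}    p≼e _    = p≼e
≼-min∞⁺ {e = just _} {just _}     p≼e p≼e′ = ⊓-glb p≼e p≼e′

≼-min∞⁻ : ∀ {e e′} → p ≼ min∞ e e′ → p ≼ e × p ≼ e′
≼-min∞⁻ {e = nothing}             p≼e′ = tt , p≼e′
≼-min∞⁻ {e = just _} {nothing}    p≼e  = p≼e , tt
≼-min∞⁻ {e = just r} {just r′}    p≤⊓  = ≤-trans p≤⊓ (p⊓q≤p r r′) , ≤-trans p≤⊓ (p⊓q≤q r r′)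

≼-minList∞⁺ : ∀ {es} → All (p ≼_) es → p ≼ minList∞ es
≼-minList∞⁺ []         = tt
≼-minList∞⁺ (h ∷ hs) = ≼-min∞⁺ h (≼-minList∞⁺ hs)

≼-minList∞⁻ : ∀ es → p ≼ minList∞ es → All (p ≼_) es
≼-minList∞⁻ []       _ = []
≼-minList∞⁻ (e ∷ es) h with ≼-min∞⁻ {e = e} h
... | p≼e , p≼min = p≼e ∷ ≼-minList∞⁻ es p≼min

1/-nonNeg : ∀ a .{{_ : NonZero a}} → 0ℚ ≤ a → 0ℚ ≤ 1/ a
1/-nonNeg a 0≤a = <⇒≤ (positive⁻¹ _ {{1/pos⇒pos a}})
  where instance _ = nonNeg∧nonZero⇒pos a {{nonNegative 0≤a}}

0≼inv∞ : 0ℚ ≤ r → 0ℚ ≼ inv∞ r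
0≼inv∞ {r} 0≤r with r ≟ 0ℚ
... | yes _   = tt
... | no r≢0 = 1/-nonNeg r {{≢-nonZero r≢0}} 0≤r

≼-inv∞ : 0ℚ ≤ r → p ≼ inv∞ r → p * r ≤ 1ℚ
≼-inv∞ {r} {p} 0≤r p≼1/r with r ≟ 0ℚ
... | yes r≡0 = ≤-trans (≤-reflexive (trans (cong (p *_) r≡0) (*-zeroʳ p))) 0≤1
... | no r≢0  = ≤-trans (*-monoʳ-≤-nonNeg r {{nonNegative 0≤r}} p≼1/r)
                        (≤-reflexive (*-inverseˡ r {{≢-nonZero r≢0}}))

-- With a = Pr[𝐚 = x] and d i = Pr[𝐚 = x ∧ 𝐚ᵢ ≠ 𝐛ᵢ], these are the candidates x contributes to minA.
data RatioCandidates {n} (a : ℚ) (d : Fin n → ℚ) : List ℚ∞ → Set where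
  outsideSupport : a ≡ 0ℚ → RatioCandidates a d []
  ratios         : (a≢0 : a ≢ 0ℚ) →
                   RatioCandidates a d (map (λ i → inv∞ ((d i ÷ a) {{≢-nonZero a≢0}})) (allFin n))

module _ {n} {a : ℚ} {d : Fin n → ℚ} (0≤d : ∀ i → 0ℚ ≤ d i) (d≤a : ∀ i → d i ≤ a) where

  private
    ratio-nonNeg : ∀ i .{{_ : NonZero a}} → 0ℚ ≤ d i ÷ a
    ratio-nonNeg i = *-nonNeg (0≤d i) (1/-nonNeg a (≤-trans (0≤d i) (d≤a i)))

    ratio*a≡d : ∀ i .{{_ : NonZero a}} → (d i ÷ a) * a ≡ d i
    ratio*a≡d i = trans (*-assoc (d i) (1/ a) a) (trans (cong (d i *_) (*-inverseˡ a)) (*-identityʳ (d i)))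

  ratioCandidates-nonNeg : ∀ {es} → RatioCandidates a d es → All (0ℚ ≼_) es
  ratioCandidates-nonNeg (outsideSupport _) = []
  ratioCandidates-nonNeg (ratios a≢0) =
    All.map⁺ (All.universal (λ i → 0≼inv∞ (ratio-nonNeg i {{≢-nonZero a≢0}})) (allFin n))

  ratioCandidates-bound : ∀ {es} → RatioCandidates a d es → All (p ≼_) es → ∀ i → p * d i ≤ a
  ratioCandidates-bound {p} (outsideSupport a≡0) _ i = ≤-reflexive (begin-equality
    p * d i ≡⟨ cong (p *_) (≤-antisym (subst (d i ≤_) a≡0 (d≤a i)) (0≤d i)) ⟩
    p * 0ℚ  ≡⟨ *-zeroʳ p ⟩
    0ℚ      ≡⟨ a≡0 ⟨
    a       ∎)
  ratioCandidates-bound {p} (ratios a≢0) p≼es i = begin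
    p * d i             ≡⟨ cong (p *_) (ratio*a≡d i) ⟨
    p * ((d i ÷ a) * a) ≡⟨ *-assoc p (d i ÷ a) a ⟨
    p * (d i ÷ a) * a   ≤⟨ *-monoʳ-≤-nonNeg a {{nonNegative (≤-trans (0≤d i) (d≤a i))}}
                             (≼-inv∞ (ratio-nonNeg i) (All.lookup (All.map⁻ p≼es) (∈-allFin i))) ⟩
    1ℚ * a              ≡⟨ *-identityˡ a ⟩
    a                   ∎
    where instance _ = ≢-nonZero a≢0

≼-minList∞-concatMap⁺ : ∀ {A : Set} {g : A → List ℚ∞} {xs} →
  All (λ x → All (p ≼_) (g x)) xs → p ≼ minList∞ (concatMap g xs)
≼-minList∞-concatMap⁺ p≼gs = ≼-minList∞⁺ (All.concat⁺ (All.map⁺ p≼gs))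

≼-minList∞-concatMap⁻ : ∀ {A : Set} (g : A → List ℚ∞) xs →
  p ≼ minList∞ (concatMap g xs) → All (λ x → All (p ≼_) (g x)) xs
≼-minList∞-concatMap⁻ g xs p≼min = All.map⁻ (All.concat⁻ (≼-minList∞⁻ (concatMap g xs) p≼min))

-- minA and minB minimise per-input candidate lists that are local to Defs;
-- unifying with the unfolding of the minimum recovers those lists.
candidatesOf : ∀ {A : Set} {g : A → List ℚ∞} {xs m} → m ≡ minList∞ (concatMap g xs) → A → List ℚ∞
candidatesOf {g = g} _ = g

p<p+1 : ∀ p → p < p + 1ℚ
p<p+1 p = subst (_< p + 1ℚ) (+-identityʳ p) (+-monoʳ-< p (positive⁻¹ 1ℚ))

p+1≰p : ∀ p → p + 1ℚ ≰ p
p+1≰p p p+1≤p = <-irrefl refl (<-≤-trans (p<p+1 p) p+1≤p)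

0≤toℚ+1 : ∀ k → 0ℚ ≤ toℚ k + 1ℚ
0≤toℚ+1 k = ≤-trans (toℚ-nonNeg k) (<⇒≤ (p<p+1 (toℚ k)))

module _ {n : ℕ} {f : BoolFun n} (D : Distribution f) where

  private
    candidatesA candidatesB : (Fin n → Bool) → List ℚ∞
    candidatesA = candidatesOf {xs = allInputs n} (refl {x = minA D})
    candidatesB = candidatesOf {xs = allInputs n} (refl {x = minB D})

    candidatesA-ratios : ∀ x → RatioCandidates (PrA D x) (PrADiff D x) (candidatesA x)
    candidatesA-ratios x with PrA D x ≟ 0ℚ
    ... | yes a≡0 = outsideSupport a≡0
    ... | no a≢0  = ratios a≢0

    candidatesB-ratios : ∀ y → RatioCandidates (PrB D y) (PrBDiff D y) (candidatesB y)
    candidatesB-ratios y with PrB D y ≟ 0ℚ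
    ... | yes b≡0 = outsideSupport b≡0
    ... | no b≢0  = ratios b≢0

  0≼minA : 0ℚ ≼ minA D
  0≼minA = ≼-minList∞-concatMap⁺ (All.universal (λ x →
    ratioCandidates-nonNeg (PrADiff-nonNeg D x) (PrADiff≤PrA D x) (candidatesA-ratios x)) (allInputs n))

  0≼minB : 0ℚ ≼ minB D
  0≼minB = ≼-minList∞-concatMap⁺ (All.universal (λ y →
    ratioCandidates-nonNeg (PrBDiff-nonNeg D y) (PrBDiff≤PrB D y) (candidatesB-ratios y)) (allInputs n))

  ≼minA⇒rowBounded : p ≼ minA D → RowBounded D p
  ≼minA⇒rowBounded p≼min = All.map (λ {x} →
      ratioCandidates-bound (PrADiff-nonNeg D x) (PrADiff≤PrA D x) (candidatesA-ratios x))
    (≼-minList∞-concatMap⁻ candidatesA (allInputs n) p≼min)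

  ≼minB⇒colBounded : q ≼ minB D → ColBounded D q
  ≼minB⇒colBounded q≼min = All.map (λ {y} →
      ratioCandidates-bound (PrBDiff-nonNeg D y) (PrBDiff≤PrB D y) (candidatesB-ratios y))
    (≼-minList∞-concatMap⁻ candidatesB (allInputs n) q≼min)

  -- If minA were ∞, every p ≥ 0 would be admissible, yet p · 1 ≤ L(F) fails at p = L(F) + 1.
  minA-finite : ∀ F → Computes F f → minA D ≢ nothing
  minA-finite F computes minA≡∞ = p+1≰p L (subst (_≤ L) (*-identityʳ (L + 1ℚ))
    (formula-softBound D (0≤toℚ+1 (leaves F)) 0≤1
      (≼minA⇒rowBounded (subst ((L + 1ℚ) ≼_) (sym minA≡∞) tt)) (colBounded-1 D) F computes))
    where L = toℚ (leaves F)

  minB-finite : ∀ F → Computes F f → minB D ≢ nothing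
  minB-finite F computes minB≡∞ = p+1≰p L (subst (_≤ L) (*-identityˡ (L + 1ℚ))
    (formula-softBound D 0≤1 (0≤toℚ+1 (leaves F))
      (rowBounded-1 D) (≼minB⇒colBounded (subst ((L + 1ℚ) ≼_) (sym minB≡∞) tt)) F computes))
    where L = toℚ (leaves F)

proposition6p13 : ∀ (n : ℕ) (f : BoolFun n) (F : Formula n) → Computes F f →
    AdvSoft≤ f ((+ leaves F) / 1)
proposition6p13 n f F computes D with minA D in minA≡ | minB D in minB≡
... | just p  | just q  =
  formula-softBound D 0≤p 0≤q (≼minA⇒rowBounded D p≼minA) (≼minB⇒colBounded D q≼minB) F computes
  where
  0≤p = subst (0ℚ ≼_) minA≡ (0≼minA D)
  0≤q = subst (0ℚ ≼_) minB≡ (0≼minB D)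
  p≼minA = subst (p ≼_) (sym minA≡) ≤-refl
  q≼minB = subst (q ≼_) (sym minB≡) ≤-refl
... | nothing | _       = contradiction minA≡ (minA-finite D F computes)
... | just _  | nothing = contradiction minB≡ (minB-finite D F computes)
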